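{- Let $G=(V,E)$ be an $n$-vertex graph, $O^\star$ a minimum vertex cover of $G$, and let the sets $O_i,\overline{O}_i$ ($i\in[\tau]$) be produced by the hypothetical peeling process described in the context. Then $\left|\bigcup_{i=1}^{\tau}(O_i\cup\overline{O}_i)\right| = O(\log n)\cdot \mathrm{opt}(G)$, where $\mathrm{opt}(G)$ is the minimum vertex cover size of $G$.
   Context: Logarithms are base 2. Degree thresholds: $\Delta_1:=n$, $\Delta_i:=n^{1/2^{i-1}}$ (so $\Delta_{i+1}=\sqrt{\Delta_i}$) for $\tau=O(\log\log n)$ phases, with the last threshold set to $\Delta_\tau:=4\log n$ and $\Delta_{\tau+1}:=\sqrt{\Delta_\tau}$. Removing vertices means deleting them and their incident edges. Let $\overline{O^\star}:=V\setminus O^\star$. Hypothetical process: let $H_1$ be obtained from $G$ by deleting all edges with both endpoints in $O^\star$. For $i=1,\dots,\tau$: set $H_{i,1}:=H_i$, $O_i:=\overline{O}_i:=\emptyset$; for $t=1,\dots,\lceil\log\Delta_{i+1}\rceil$, let $O_{i,t}$ be the vertices of $O^\star$ of degree at least $\Delta_i/2^t$ in $H_{i,t}$, let $\overline{O}_{i,t}$ be the vertices of $\overline{O^\star}$ of degree at least $\Delta_i/2^{t+2}$ in $H_{i,t}$, let $H_{i,t+1}:=H_{i,t}$ with $O_{i,t}\cup\overline{O}_{i,t}$ removed, and add $O_{i,t}$ to $O_i$ and $\overline{O}_{i,t}$ to $\overline{O}_i$. Then $H_{i+1}:=H_i$ with $O_i\cup\overline{O}_i$ removed. -}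

module Defs where

open import Data.Nat using (ℕ; zero; suc; _+_; _*_; _^_; _∸_; _≤_; _<_; _≤ᵇ_; _<ᵇ_; _≡ᵇ_)
open import Data.Bool using (Bool; true; false; _∧_; _∨_; not; if_then_else_)
open import Data.Fin using (Fin)
open import Data.Fin.Subset using (Subset; ∣_∣; _∪_; ⊥; ⊤)
open import Data.Vec using (lookup; tabulate)
open import Data.Product using (_×_)
open import Data.Sum using (_⊎_)
open import Relation.Nullary using (¬_)
open import Relation.Binary.PropositionalEquality using (_≡_)

record Graph (n : ℕ) : Set where
  field
    adj    : Fin n → Fin n → Bool
    sym    : ∀ u v → adj u v ≡ adj v u
    irrefl : ∀ v → adj v v ≡ false
open Graph public

IsVertexCover : ∀ {n} → Graph n → Subset n → Set
IsVertexCover G C = ∀ u v → adj G u v ≡ true → lookup C u ≡ true ⊎ lookup C v ≡ true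

IsMinVertexCover : ∀ {n} → Graph n → Subset n → Set
IsMinVertexCover G C = IsVertexCover G C × (∀ D → IsVertexCover G D → ∣ C ∣ ≤ ∣ D ∣)

-- A subgraph arising in the process: an edge relation E together with the
-- set A of vertices still present (removed vertices and their edges are gone).
record SubG (n : ℕ) : Set where
  field
    E : Fin n → Fin n → Bool
    A : Subset n
open SubG public

-- degree of v in H (0 if v has been removed)
deg : ∀ {n} → SubG n → Fin n → ℕ
deg H v = ∣ tabulate (λ u → lookup (A H) v ∧ (lookup (A H) u ∧ E H v u)) ∣

removeV : ∀ {n} → SubG n → Subset n → SubG n
removeV H S = record { E = E H ; A = tabulate (λ v → lookup (A H) v ∧ not (lookup S v)) }

-- Thresholds.  geΔ n τ i m = true  iff  the natural number m is ≥ Δ_i, where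
--   Δ_i = n^(1/2^(i-1))   for 1 ≤ i < τ      (m ≥ Δ_i  ⇔  m^(2^(i-1)) ≥ n)
--   Δ_τ = 4 log₂ n                           (m ≥ Δ_τ  ⇔  2^m ≥ n^4)
--   Δ_{τ+1} = sqrt(4 log₂ n)                 (m ≥ Δ_{τ+1} ⇔ 2^(m*m) ≥ n^4)
geΔ : ℕ → ℕ → ℕ → ℕ → Bool
geΔ n τ i m =
  if i <ᵇ τ then n ≤ᵇ m ^ (2 ^ (i ∸ 1))
  else if i ≡ᵇ τ then n ^ 4 ≤ᵇ 2 ^ m
  else n ^ 4 ≤ᵇ 2 ^ (m * m)

-- least t < k with p t (k if none)
search : (ℕ → Bool) → ℕ → ℕ
search p zero = zero
search p (suc k) = if p 0 then 0 else suc (search (λ t → p (suc t)) k)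

-- number of inner steps of phase i:  ⌈log₂ Δ_{i+1}⌉ = least t with 2^t ≥ Δ_{i+1}
-- (the search bound 4n+4 is never reached since Δ_{i+1} ≤ max(n, 4 log₂ n)).
steps : ℕ → ℕ → ℕ → ℕ
steps n τ i = search (λ t → geΔ n τ (suc i) (2 ^ t)) (4 * n + 4)

module Process {n : ℕ} (G : Graph n) (O⋆ : Subset n) (τ : ℕ) where

  inO : Fin n → Bool
  inO v = lookup O⋆ v

  H₁ : SubG n
  H₁ = record { E = λ u v → adj G u v ∧ not (inO u ∧ inO v) ; A = ⊤ }

  -- O_{i,t}: vertices of O⋆ of degree ≥ Δ_i / 2^t in H
  Oit : ℕ → ℕ → SubG n → Subset n
  Oit i t H = tabulate (λ v → lookup (A H) v ∧ (inO v ∧ geΔ n τ i (deg H v * 2 ^ t)))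

  -- Ō_{i,t}: vertices outside O⋆ of degree ≥ Δ_i / 2^(t+2) in H
  Obit : ℕ → ℕ → SubG n → Subset n
  Obit i t H = tabulate (λ v → lookup (A H) v ∧ (not (inO v) ∧ geΔ n τ i (deg H v * 2 ^ (t + 2))))

  -- inner loop of phase i, starting at step t with r steps left, on H_{i,t};
  -- returns the accumulated (O_i, Ō_i) from these steps
  inner : ℕ → ℕ → ℕ → SubG n → Subset n × Subset n
  inner i t zero H = ⊥ Data.Product., ⊥
  inner i t (suc r) H =
    let O  = Oit i t H
        Ob = Obit i t H
        rest = inner i (suc t) r (removeV H (O ∪ Ob))
    in (O ∪ Data.Product.proj₁ rest) Data.Product., (Ob ∪ Data.Product.proj₂ rest)

  mutual
    -- H_i  (for i ≥ 1)
    Hph : ℕ → SubG n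
    Hph zero = H₁
    Hph (suc zero) = H₁
    Hph (suc (suc i)) = removeV (Hph (suc i)) (Oi (suc i) ∪ Obi (suc i))

    Oi : ℕ → Subset n
    Oi i = Data.Product.proj₁ (inner i 1 (steps n τ i) (Hph i))

    Obi : ℕ → Subset n
    Obi i = Data.Product.proj₂ (inner i 1 (steps n τ i) (Hph i))

  unionUpTo : ℕ → Subset n
  unionUpTo zero = ⊥
  unionUpTo (suc k) = unionUpTo k ∪ (Oi (suc k) ∪ Obi (suc k))

  allRemoved : Subset n
  allRemoved = unionUpTo τ

-- The number of phases τ: the least i ≥ 1 with n^(1/2^(i-1)) ≤ 4 log₂ n.
-- RawLe n i  ⇔  n^(1/2^(i-1)) ≤ 4 log₂ n, expressed exactly via rationals p/q:
-- x ≤ L iff every rational p/q ≤ x satisfies p/q ≤ L, with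
-- p/q ≤ n^(1/k) ⇔ p^k ≤ n q^k  and  p/q ≤ log₂ (n^4) ⇔ 2^p ≤ n^(4q).
RawLe : ℕ → ℕ → Set
RawLe n i = ∀ p q → 1 ≤ q → p ^ (2 ^ (i ∸ 1)) ≤ n * q ^ (2 ^ (i ∸ 1)) → 2 ^ p ≤ n ^ (4 * q)

IsTau : ℕ → ℕ → Set
IsTau n τ = 1 ≤ τ × RawLe n τ × (∀ i → 1 ≤ i → i < τ → ¬ RawLe n i)

module Submission where

-- All O_i lie in O⋆, so only the sets Ō_{i,t} have to be paid for. Because O⋆ is a vertex cover and H₁
-- keeps no edge inside O⋆, every edge at a vertex outside O⋆ leads into O⋆. When step t of phase i starts,
-- the vertices of O⋆ still present have degree < Δ_i/2^(t-1), while those of Ō_{i,t} have degree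
-- ≥ Δ_i/2^(t+2) with all neighbours in O⋆; double counting these edges gives |Ō_{i,t}| ≤ 8|O⋆|.
-- After the ⌈log Δ_{i+1}⌉ steps of phase i the O⋆-degrees are below Δ_i/Δ_{i+1} ≤ Δ_{i+1}, which is
-- the invariant of phase i+1. The step counts, about log n / 2^i, sum to O(log n), so at most
-- |O⋆| + 8|O⋆| · O(log n) vertices are removed.

open import Defs
open import Data.Nat using (ℕ; _*_; _≤_)
open import Data.Nat.Logarithm using (⌊log₂_⌋)
open import Data.Fin.Subset using (Subset; ∣_∣)
open import Data.Product using (∃-syntax)

open import Algebra.Bundles using (CommutativeMonoid)
import Algebra.Properties.CommutativeSemigroup as CommutativeSemigroupProperties
open import Data.Bool using (Bool; true; false; _∧_; _∨_; not)
open import Data.Bool.Properties using (∧-zeroʳ; ∨-conicalˡ)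
open import Data.Empty using (⊥-elim)
open import Data.Fin using (Fin; zero; suc)
open import Data.Fin.Subset using (_∪_; _⊆_; _∈_; ⊤) renaming (⊥ to ∅)
open import Data.Fin.Subset.Properties
  using (p⊆q⇒∣p∣≤∣q∣; p⊂q⇒∣p∣<∣q∣; ∣p∣≤∣x∷p∣; ∣⊤∣≡n; ∣⊥∣≡0; ⊆⊤; ∈⊤; ∉⊥; x∈p∪q⁻; x∈p∪q⁺; ∪-commutativeMonoid)
open import Data.Nat using (zero; suc; _+_; _^_; _∸_; _<_; _≤ᵇ_; _<ᵇ_; _≡ᵇ_; z≤n; s≤s; ⌊_/2⌋)
open import Data.Nat.Logarithm using (⌊log₂⌋-mono-≤; ⌊log₂⌊n/2⌋⌋≡⌊log₂n⌋∸1; ⌊log₂[2^n]⌋≡n)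
open import Data.Nat.Properties
open import Data.Nat.Tactic.RingSolver using (solve-∀)
open import Data.Product using (_×_; _,_; proj₁; proj₂)
open import Data.Sum using (inj₁; inj₂; [_,_]′)
open import Data.Vec using ([]; _∷_; lookup; tabulate)
open import Data.Vec.Properties using (lookup∘tabulate; tabulate-cong; lookup-zipWith; []=⇒lookup; lookup⇒[]=)
open import Relation.Nullary using (¬_; proof)
open import Relation.Nullary.Reflects using (Reflects; ofʸ; ofⁿ)
open import Relation.Binary.Definitions using (tri<; tri≈; tri>)
open import Relation.Binary.PropositionalEquality as ≡
  using (_≡_; refl; trans; cong; cong₂; subst; subst₂; module ≡-Reasoning)
open import Algebra.Properties.Semiring.Sum +-*-semiring
  using (sum; ∑-comm; *-distribˡ-sum; *-distribʳ-sum; sum-cong-≗)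
open CommutativeSemigroupProperties *-commutativeSemigroup using () renaming (interchange to *-interchange)

∧-true⁻ : ∀ {a b} → a ∧ b ≡ true → a ≡ true × b ≡ true
∧-true⁻ {true} {true} _ = refl , refl

∧-true⁺ : ∀ {a b} → a ≡ true → b ≡ true → a ∧ b ≡ true
∧-true⁺ refl refl = refl

not-true⁻ : ∀ {a} → not a ≡ true → a ≡ false
not-true⁻ {false} _ = refl

true≢false : ¬ true ≡ false
true≢false ()

≢true⇒≡false : ∀ {a} → ¬ a ≡ true → a ≡ false
≢true⇒≡false {true}  a≢true = ⊥-elim (a≢true refl)
≢true⇒≡false {false} _      = refl

∧-not-∨ : ∀ a x y → a ∧ not (x ∨ y) ≡ (a ∧ not x) ∧ not y
∧-not-∨ false x     y = refl
∧-not-∨ true  true  y = refl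
∧-not-∨ true  false y = refl

reflects-true⁻ : ∀ {P : Set} {b} → Reflects P b → b ≡ true → P
reflects-true⁻ (ofʸ p) _ = p

reflects-true⁺ : ∀ {P : Set} {b} → Reflects P b → P → b ≡ true
reflects-true⁺ (ofʸ _)  _ = refl
reflects-true⁺ (ofⁿ ¬p) p = ⊥-elim (¬p p)

reflects-false⁺ : ∀ {P : Set} {b} → Reflects P b → ¬ P → b ≡ false
reflects-false⁺ (ofʸ p) ¬p = ⊥-elim (¬p p)
reflects-false⁺ (ofⁿ _) _  = refl

≡ᵇ-reflects-≡ : ∀ m n → Reflects (m ≡ n) (m ≡ᵇ n)
≡ᵇ-reflects-≡ m n = proof (m ≟ n)

≤ᵇ-true⁻ : ∀ {m n} → (m ≤ᵇ n) ≡ true → m ≤ n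
≤ᵇ-true⁻ {m} {n} = reflects-true⁻ (≤ᵇ-reflects-≤ m n)

≤ᵇ-true⁺ : ∀ {m n} → m ≤ n → (m ≤ᵇ n) ≡ true
≤ᵇ-true⁺ {m} {n} = reflects-true⁺ (≤ᵇ-reflects-≤ m n)

≤ᵇ-false⁺ : ∀ {m n} → ¬ m ≤ n → (m ≤ᵇ n) ≡ false
≤ᵇ-false⁺ {m} {n} = reflects-false⁺ (≤ᵇ-reflects-≤ m n)

-- Counting

indicator : Bool → ℕ
indicator true  = 1
indicator false = 0

count : ∀ {n} → (Fin n → Bool) → ℕ
count f = sum (λ v → indicator (f v))

∑-mono-≤ : ∀ {n} {f g : Fin n → ℕ} → (∀ i → f i ≤ g i) → sum f ≤ sum g
∑-mono-≤ {zero}  f≤g = z≤n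
∑-mono-≤ {suc n} f≤g = +-mono-≤ (f≤g zero) (∑-mono-≤ (λ i → f≤g (suc i)))

indicator-∧ : ∀ a b → indicator (a ∧ b) ≡ indicator a * indicator b
indicator-∧ true  b = ≡.sym (+-identityʳ (indicator b))
indicator-∧ false b = refl

indicator-mono : ∀ {a b} → (a ≡ true → b ≡ true) → indicator a ≤ indicator b
indicator-mono {false} _   = z≤n
indicator-mono {true}  a⇒b rewrite a⇒b refl = ≤-refl

∣tabulate∣≡count : ∀ {n} (f : Fin n → Bool) → ∣ tabulate f ∣ ≡ count f
∣tabulate∣≡count {zero}  f = refl
∣tabulate∣≡count {suc n} f with f zero
... | true  = cong suc (∣tabulate∣≡count (λ v → f (suc v)))
... | false = ∣tabulate∣≡count (λ v → f (suc v))

∣tabulate∣-mono : ∀ {n} {f g : Fin n → Bool} → (∀ v → f v ≡ true → g v ≡ true) → ∣ tabulate f ∣ ≤ ∣ tabulate g ∣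
∣tabulate∣-mono {f = f} {g} f⇒g = begin
  ∣ tabulate f ∣ ≡⟨ ∣tabulate∣≡count f ⟩
  count f        ≤⟨ ∑-mono-≤ (λ v → indicator-mono (f⇒g v)) ⟩
  count g        ≡⟨ ≡.sym (∣tabulate∣≡count g) ⟩
  ∣ tabulate g ∣ ∎
  where open ≤-Reasoning

m≤o⇒m*o≤n*o⇒m≤n : ∀ {m n o} → m ≤ o → m * o ≤ n * o → m ≤ n
m≤o⇒m*o≤n*o⇒m≤n {o = zero}  m≤0 _     = ≤-trans m≤0 z≤n
m≤o⇒m*o≤n*o⇒m≤n {m} {n} {o = suc o} _ m*o≤n*o = *-cancelʳ-≤ m n (suc o) m*o≤n*o

module DoubleCounting {n : ℕ} (R : Fin n → Fin n → Bool) where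

  degree : Fin n → ℕ
  degree v = ∣ tabulate (R v) ∣

  volume : (Fin n → Bool) → ℕ
  volume X = sum (λ v → indicator (X v) * degree v)

  volume-mono : ∀ {X Y : Fin n → Bool} → (∀ {v u} → X v ≡ true → R v u ≡ true → Y u ≡ true × R u v ≡ true)
              → volume X ≤ volume Y
  volume-mono {X} {Y} edge = begin
      volume X
    ≡⟨ sum-cong-≗ (λ v → expand X v) ⟩
      sum (λ v → sum (λ u → indicator (X v) * indicator (R v u)))
    ≤⟨ ∑-mono-≤ (λ v → ∑-mono-≤ (λ u → edge-≤ v u)) ⟩
      sum (λ v → sum (λ u → indicator (Y u) * indicator (R u v)))
    ≡⟨ ∑-comm (λ v u → indicator (Y u) * indicator (R u v)) ⟩
      sum (λ u → sum (λ v → indicator (Y u) * indicator (R u v)))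
    ≡⟨ sum-cong-≗ (λ u → ≡.sym (expand Y u)) ⟩
      volume Y ∎
    where
    open ≤-Reasoning
    expand : ∀ Z v → indicator (Z v) * degree v ≡ sum (λ u → indicator (Z v) * indicator (R v u))
    expand Z v = trans (cong (indicator (Z v) *_) (∣tabulate∣≡count (R v))) (*-distribˡ-sum {n} (indicator (Z v)) (λ u → indicator (R v u)))
    edge-≤ : ∀ v u → indicator (X v) * indicator (R v u) ≤ indicator (Y u) * indicator (R u v)
    edge-≤ v u = begin
      indicator (X v) * indicator (R v u) ≡⟨ ≡.sym (indicator-∧ (X v) (R v u)) ⟩
      indicator (X v ∧ R v u)             ≤⟨ indicator-mono edge′ ⟩
      indicator (Y u ∧ R u v)             ≡⟨ indicator-∧ (Y u) (R u v) ⟩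
      indicator (Y u) * indicator (R u v) ∎
      where
      edge′ : X v ∧ R v u ≡ true → Y u ∧ R u v ≡ true
      edge′ e = let x , r = ∧-true⁻ {X v} e ; y , r′ = edge x r in ∧-true⁺ y r′

  ∣tabulate∣≤volume : ∀ {X : Fin n → Bool} → (∀ {v} → X v ≡ true → 1 ≤ degree v) → ∣ tabulate X ∣ ≤ volume X
  ∣tabulate∣≤volume {X} pos = ≤-trans (≤-reflexive (∣tabulate∣≡count X)) (∑-mono-≤ weight)
    where
    weight : ∀ v → indicator (X v) ≤ indicator (X v) * degree v
    weight v with X v in Xv
    ... | true  = ≤-trans (pos Xv) (m≤m+n (degree v) 0)
    ... | false = z≤n

  volume≤∣tabulate∣* : ∀ {Y : Fin n → Bool} {m} → (∀ {u} → Y u ≡ true → degree u ≤ m) → volume Y ≤ ∣ tabulate Y ∣ * m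
  volume≤∣tabulate∣* {Y} {m} bound = begin
    volume Y                          ≤⟨ ∑-mono-≤ weight ⟩
    sum (λ u → indicator (Y u) * m)   ≡⟨ ≡.sym (*-distribʳ-sum m (λ u → indicator (Y u))) ⟩
    count Y * m                       ≡⟨ cong (_* m) (≡.sym (∣tabulate∣≡count Y)) ⟩
    ∣ tabulate Y ∣ * m                ∎
    where
    open ≤-Reasoning
    weight : ∀ u → indicator (Y u) * degree u ≤ indicator (Y u) * m
    weight u with Y u in Yu
    ... | true  = *-monoʳ-≤ 1 (bound Yu)
    ... | false = z≤n

  -- Each vertex of X is compared with the whole volume of Y, which avoids choosing a vertex of minimum degree.
  double-counting : ∀ {X Y : Fin n → Bool} c
    → (∀ {v u} → X v ≡ true → R v u ≡ true → Y u ≡ true × R u v ≡ true)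
    → (∀ {v} → X v ≡ true → 1 ≤ degree v)
    → (∀ {v u} → X v ≡ true → Y u ≡ true → degree u ≤ c * degree v)
    → ∣ tabulate X ∣ ≤ c * ∣ tabulate Y ∣
  double-counting {X} {Y} c edge pos ratio =
    m≤o⇒m*o≤n*o⇒m≤n (≤-trans (∣tabulate∣≤volume pos) (volume-mono edge)) weighted
    where
    open ≤-Reasoning
    V = volume Y
    cY = c * ∣ tabulate Y ∣
    per-vertex : ∀ v → indicator (X v) * V ≤ cY * (indicator (X v) * degree v)
    per-vertex v with X v in Xv
    ... | false = z≤n
    ... | true  = begin
      1 * V                              ≡⟨ *-identityˡ V ⟩
      V                                  ≤⟨ volume≤∣tabulate∣* (ratio Xv) ⟩
      ∣ tabulate Y ∣ * (c * degree v)    ≡⟨ rearrange ∣ tabulate Y ∣ c (degree v) ⟩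
      cY * (1 * degree v)                ∎
      where
      rearrange : ∀ a b d → a * (b * d) ≡ b * a * (1 * d)
      rearrange = solve-∀
    weighted : ∣ tabulate X ∣ * V ≤ cY * V
    weighted = begin
      ∣ tabulate X ∣ * V                              ≡⟨ cong (_* V) (∣tabulate∣≡count X) ⟩
      count X * V                                     ≡⟨ *-distribʳ-sum V (λ v → indicator (X v)) ⟩
      sum (λ v → indicator (X v) * V)                 ≤⟨ ∑-mono-≤ per-vertex ⟩
      sum (λ v → cY * (indicator (X v) * degree v))   ≡⟨ ≡.sym (*-distribˡ-sum {n} cY (λ v → indicator (X v) * degree v)) ⟩
      cY * volume X                                   ≤⟨ *-monoʳ-≤ cY (volume-mono edge) ⟩
      cY * V                                          ∎

∣p∪q∣≤∣p∣+∣q∣ : ∀ {n} (p q : Subset n) → ∣ p ∪ q ∣ ≤ ∣ p ∣ + ∣ q ∣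
∣p∪q∣≤∣p∣+∣q∣ []          []          = z≤n
∣p∪q∣≤∣p∣+∣q∣ (true ∷ p)  (y ∷ q)     = s≤s (≤-trans (∣p∪q∣≤∣p∣+∣q∣ p q) (+-monoʳ-≤ ∣ p ∣ (∣p∣≤∣x∷p∣ y q)))
∣p∪q∣≤∣p∣+∣q∣ (false ∷ p) (true ∷ q)  = ≤-trans (s≤s (∣p∪q∣≤∣p∣+∣q∣ p q)) (≤-reflexive (≡.sym (+-suc ∣ p ∣ ∣ q ∣)))
∣p∪q∣≤∣p∣+∣q∣ (false ∷ p) (false ∷ q) = ∣p∪q∣≤∣p∣+∣q∣ p q

∈-tabulate⁻ : ∀ {n} {f : Fin n → Bool} {x} → x ∈ tabulate f → f x ≡ true
∈-tabulate⁻ {f = f} {x} x∈ = trans (≡.sym (lookup∘tabulate f x)) ([]=⇒lookup x∈)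

∣tabulate∣<n : ∀ {n} (f : Fin n → Bool) v → f v ≡ false → ∣ tabulate f ∣ < n
∣tabulate∣<n {n} f v fv≡false = subst (∣ tabulate f ∣ <_) (∣⊤∣≡n n) (p⊂q⇒∣p∣<∣q∣ (⊆⊤ , v , ∈⊤ , v∉))
  where
  v∉ : ¬ v ∈ tabulate f
  v∉ v∈ with () ← trans (≡.sym (∈-tabulate⁻ v∈)) fv≡false

-- Arithmetic

^-distribʳ-* : ∀ a b k → (a * b) ^ k ≡ a ^ k * b ^ k
^-distribʳ-* a b zero    = refl
^-distribʳ-* a b (suc k) = trans (cong ((a * b) *_) (^-distribʳ-* a b k)) (*-interchange a b (a ^ k) (b ^ k))

^-2^suc : ∀ a j → a ^ (2 ^ suc j) ≡ a ^ (2 ^ j) * a ^ (2 ^ j)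
^-2^suc a j = trans (cong (a ^_) (cong (2 ^ j +_) (+-identityʳ (2 ^ j)))) (^-distribˡ-+-* a (2 ^ j) (2 ^ j))

n<2^n : ∀ n → n < 2 ^ n
n<2^n zero    = s≤s z≤n
n<2^n (suc n) = ≤-trans (s≤s (n<2^n n))
  (≤-trans (≤-reflexive (+-comm 1 (2 ^ n))) (+-monoʳ-≤ (2 ^ n) (≤-trans (m^n>0 2 n) (m≤m+n (2 ^ n) 0))))

binomial-≤ : ∀ x j → suc x ^ suc j ≤ x ^ suc j + suc j * suc x ^ j
binomial-≤ x zero    = ≤-reflexive (+-comm 1 (x * 1))
binomial-≤ x (suc j) = begin
    suc x * suc x ^ suc j
  ≤⟨ *-monoʳ-≤ (suc x) (binomial-≤ x j) ⟩
    suc x * (x ^ suc j + suc j * suc x ^ j)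
  ≡⟨ expand x j (x ^ suc j) (suc x ^ j) ⟩
    x ^ suc (suc j) + (x ^ suc j + suc j * suc x ^ suc j)
  ≤⟨ +-monoʳ-≤ (x ^ suc (suc j)) (+-monoˡ-≤ (suc j * suc x ^ suc j) (^-monoˡ-≤ (suc j) (n≤1+n x))) ⟩
    x ^ suc (suc j) + suc (suc j) * suc x ^ suc j
  ∎
  where
  open ≤-Reasoning
  expand : ∀ x j a b → suc x * (a + suc j * b) ≡ x * a + (a + suc j * (suc x * b))
  expand = solve-∀

-- n^(1/K) ≤ log₂ (n^4), read through rationals p/q as in Defs: RawLe n i is RootBelowLog n (2^(i-1)).
RootBelowLog : ℕ → ℕ → Set
RootBelowLog n K = ∀ p q → 1 ≤ q → p ^ K ≤ n * q ^ K → 2 ^ p ≤ n ^ (4 * q)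

-- If m^K < n, the rational p/q with q = K(m+1)^K, p = mq + 1 lies strictly between m and n^(1/K);
-- by the binomial bound, p^K ≤ n q^K, yet 2^p > n^(4q) since 2^m ≥ n^4.
RootBelowLog⇒n≤m^K : ∀ {n m K} → 1 ≤ n → 1 ≤ K → RootBelowLog n K → n ^ 4 ≤ 2 ^ m → n ≤ m ^ K
RootBelowLog⇒n≤m^K {suc n′} {m} {suc K′} (s≤s z≤n) (s≤s z≤n) below n⁴≤2^m =
  ≮⇒≥ (λ m^K<n → <⇒≱ n^4q<2^p (below p q 1≤q (p^K≤nq^K m^K<n)))
  where
  n = suc n′
  K = suc K′
  q = K * suc m ^ K
  p = suc (m * q)
  1≤q : 1 ≤ q
  1≤q = *-mono-≤ (s≤s (z≤n {K′})) (m^n>0 (suc m) K)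
  p^K≤nq^K : m ^ K < n → p ^ K ≤ n * q ^ K
  p^K≤nq^K m^K<n = begin
      p ^ K
    ≤⟨ binomial-≤ (m * q) K′ ⟩
      (m * q) ^ K + K * p ^ K′
    ≤⟨ +-monoʳ-≤ ((m * q) ^ K) (*-monoʳ-≤ K (^-monoˡ-≤ K′ (+-monoˡ-≤ (m * q) 1≤q))) ⟩
      (m * q) ^ K + K * (suc m * q) ^ K′
    ≡⟨ cong₂ (λ a b → a + K * b) (^-distribʳ-* m q K) (^-distribʳ-* (suc m) q K′) ⟩
      m ^ K * q ^ K + K * (suc m ^ K′ * q ^ K′)
    ≤⟨ +-monoʳ-≤ (m ^ K * q ^ K) (*-monoʳ-≤ K (*-monoˡ-≤ (q ^ K′) (^-monoʳ-≤ (suc m) (n≤1+n K′)))) ⟩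
      m ^ K * q ^ K + K * (suc m ^ K * q ^ K′)
    ≡⟨ cong (m ^ K * q ^ K +_) (≡.sym (*-assoc K (suc m ^ K) (q ^ K′))) ⟩
      m ^ K * q ^ K + q ^ K
    ≡⟨ +-comm (m ^ K * q ^ K) (q ^ K) ⟩
      suc (m ^ K) * q ^ K
    ≤⟨ *-monoˡ-≤ (q ^ K) m^K<n ⟩
      n * q ^ K
    ∎
    where open ≤-Reasoning
  n^4q<2^p : n ^ (4 * q) < 2 ^ p
  n^4q<2^p = begin-strict
      n ^ (4 * q)
    <⟨ m<m+n (n ^ (4 * q)) (m^n>0 n (4 * q)) ⟩
      n ^ (4 * q) + n ^ (4 * q)
    ≡⟨ cong (n ^ (4 * q) +_) (≡.sym (+-identityʳ (n ^ (4 * q)))) ⟩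
      2 * n ^ (4 * q)
    ≡⟨ cong (2 *_) (≡.sym (^-*-assoc n 4 q)) ⟩
      2 * (n ^ 4) ^ q
    ≤⟨ *-monoʳ-≤ 2 (^-monoˡ-≤ q n⁴≤2^m) ⟩
      2 * (2 ^ m) ^ q
    ≡⟨ cong (2 *_) (^-*-assoc 2 m q) ⟩
      2 ^ p
    ∎
    where open ≤-Reasoning

⌊n/2⌋-bounds : ∀ n → ⌊ n /2⌋ + ⌊ n /2⌋ ≤ n × n ≤ suc (⌊ n /2⌋ + ⌊ n /2⌋)
⌊n/2⌋-bounds zero          = z≤n , z≤n
⌊n/2⌋-bounds (suc zero)    = z≤n , s≤s z≤n
⌊n/2⌋-bounds (suc (suc n)) with ⌊n/2⌋-bounds n
... | lower , upper = s≤s (≤-trans (≤-reflexive (+-suc ⌊ n /2⌋ ⌊ n /2⌋)) (s≤s lower))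
                    , s≤s (s≤s (≤-trans upper (≤-reflexive (≡.sym (+-suc ⌊ n /2⌋ ⌊ n /2⌋)))))

⌊log₂⌋-bounds : ∀ k n → ⌊log₂ n ⌋ ≡ k → 1 ≤ n → 2 ^ k ≤ n × n < 2 ^ suc k
⌊log₂⌋-bounds zero n log≡0 1≤n = 1≤n , ≰⇒> (λ 2≤n → 1≰0 (subst₂ _≤_ (⌊log₂[2^n]⌋≡n 1) log≡0 (⌊log₂⌋-mono-≤ 2≤n)))
  where
  1≰0 : ¬ 1 ≤ 0
  1≰0 ()
⌊log₂⌋-bounds (suc k) n log≡1+k _ = lower , upper
  where
  open ≤-Reasoning
  2≤n : 2 ≤ n
  2≤n = ≮⇒≥ (λ n<2 → 1+k≰0 (subst₂ _≤_ log≡1+k (⌊log₂[2^n]⌋≡n 0) (⌊log₂⌋-mono-≤ (≤-pred n<2))))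
    where
    1+k≰0 : ¬ suc k ≤ 0
    1+k≰0 ()
  h = ⌊ n /2⌋
  ih : 2 ^ k ≤ h × h < 2 ^ suc k
  ih = ⌊log₂⌋-bounds k h (trans (⌊log₂⌊n/2⌋⌋≡⌊log₂n⌋∸1 n) (cong (_∸ 1) log≡1+k)) (⌊n/2⌋-mono 2≤n)
  lower : 2 ^ suc k ≤ n
  lower = begin
    2 ^ suc k     ≡⟨ cong (2 ^ k +_) (+-identityʳ (2 ^ k)) ⟩
    2 ^ k + 2 ^ k ≤⟨ +-mono-≤ (proj₁ ih) (proj₁ ih) ⟩
    h + h         ≤⟨ proj₁ (⌊n/2⌋-bounds n) ⟩
    n             ∎
  upper : n < 2 ^ suc (suc k)
  upper = begin-strict
    n                         ≤⟨ proj₂ (⌊n/2⌋-bounds n) ⟩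
    suc h + h                 <⟨ +-monoʳ-< (suc h) (n<1+n h) ⟩
    suc h + suc h             ≤⟨ +-mono-≤ (proj₂ ih) (proj₂ ih) ⟩
    2 ^ suc k + 2 ^ suc k     ≡⟨ cong (2 ^ suc k +_) (≡.sym (+-identityʳ (2 ^ suc k))) ⟩
    2 ^ suc (suc k)           ∎

halve : ℕ → ℕ → ℕ
halve zero    y = y
halve (suc i) y = ⌊ halve i y /2⌋

halve-≤ : ∀ i y → halve i y ≤ y
halve-≤ zero    y = ≤-refl
halve-≤ (suc i) y = ≤-trans (⌊n/2⌋≤n (halve i y)) (halve-≤ i y)

<[1+halve]*2^ : ∀ i y → y < suc (halve i y) * 2 ^ i
<[1+halve]*2^ zero    y = ≤-reflexive (≡.sym (*-identityʳ (suc y)))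
<[1+halve]*2^ (suc i) y = begin-strict
    y                        <⟨ <[1+halve]*2^ i y ⟩
    suc a * 2 ^ i            ≤⟨ *-monoˡ-≤ (2 ^ i) (≤-trans (s≤s (proj₂ (⌊n/2⌋-bounds a))) (≤-reflexive (cong suc (≡.sym (+-suc h h))))) ⟩
    (suc h + suc h) * 2 ^ i  ≡⟨ double (suc h) (2 ^ i) ⟩
    suc h * 2 ^ suc i        ∎
  where
  open ≤-Reasoning
  a = halve i y
  h = ⌊ a /2⌋
  double : ∀ x z → (x + x) * z ≡ x * (2 * z)
  double = solve-∀

sumTo : (ℕ → ℕ) → ℕ → ℕ
sumTo f zero    = 0
sumTo f (suc k) = sumTo f k + f (suc k)

sumTo-mono-≤ : ∀ {f g} k → (∀ i → 1 ≤ i → i ≤ k → f i ≤ g i) → sumTo f k ≤ sumTo g k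
sumTo-mono-≤ zero    f≤g = z≤n
sumTo-mono-≤ (suc k) f≤g = +-mono-≤ (sumTo-mono-≤ k (λ i 1≤i i≤k → f≤g i 1≤i (m≤n⇒m≤1+n i≤k))) (f≤g (suc k) (s≤s z≤n) ≤-refl)

sumTo-*ʳ : ∀ f c k → sumTo (λ i → f i * c) k ≡ sumTo f k * c
sumTo-*ʳ f c zero    = refl
sumTo-*ʳ f c (suc k) = trans (cong (_+ f (suc k) * c) (sumTo-*ʳ f c k)) (≡.sym (*-distribʳ-+ c (sumTo f k) (f (suc k))))

sumTo-suc : ∀ f k → sumTo (λ i → suc (f i)) k ≡ k + sumTo f k
sumTo-suc f zero    = refl
sumTo-suc f (suc k) = trans (cong (_+ suc (f (suc k))) (sumTo-suc f k))
                            (trans (+-suc (k + sumTo f k) (f (suc k))) (cong suc (+-assoc k (sumTo f k) (f (suc k)))))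

sumTo-halve : ∀ y k → sumTo (λ i → halve i y) k ≤ 2 * y
sumTo-halve y k = ≤-trans (m≤m+n _ _) (with-remainder k)
  where
  with-remainder : ∀ k → sumTo (λ i → halve i y) k + 2 * halve k y ≤ 2 * y
  with-remainder zero    = ≤-refl
  with-remainder (suc k) = ≤-trans step (with-remainder k)
    where
    S = sumTo (λ i → halve i y) k
    a = halve k y
    h = ⌊ a /2⌋
    step : (S + h) + 2 * h ≤ S + 2 * a
    step = ≤-trans (≤-reflexive (+-assoc S h (2 * h)))
                   (+-monoʳ-≤ S (+-mono-≤ (⌊n/2⌋≤n a) 2h≤a))
      where
      2h≤a : 2 * h ≤ a + 0
      2h≤a = subst₂ _≤_ (cong (h +_) (≡.sym (+-identityʳ h))) (≡.sym (+-identityʳ a)) (proj₁ (⌊n/2⌋-bounds a))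

search-spec : ∀ (p : ℕ → Bool) k t → t < k → p t ≡ true → search p k ≤ t × p (search p k) ≡ true
search-spec p (suc k) t       t<k         pt with p 0 in p0
... | true = z≤n , p0
search-spec p (suc k) zero    _           pt | false with () ← trans (≡.sym pt) p0
search-spec p (suc k) (suc t) (s≤s t<k) pt | false with search-spec (λ x → p (suc x)) k t t<k pt
... | search≤t , found = s≤s search≤t , found

[1+m]*4≤2^m : ∀ {m} → 5 ≤ m → suc m * 4 ≤ 2 ^ m
[1+m]*4≤2^m 5≤m with m≤n⇒∃[o]m+o≡n 5≤m
... | k , refl = from5 k
  where
  from5 : ∀ k → suc (5 + k) * 4 ≤ 2 ^ (5 + k)
  from5 zero    = ≤ᵇ-true⁻ {24} {32} refl
  from5 (suc k) = begin
    4 + suc (5 + k) * 4          ≤⟨ +-mono-≤ (^-monoʳ-≤ 2 {2} {5 + k} (s≤s (s≤s z≤n))) (from5 k) ⟩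
    2 ^ (5 + k) + 2 ^ (5 + k)    ≡⟨ cong (2 ^ (5 + k) +_) (≡.sym (+-identityʳ (2 ^ (5 + k)))) ⟩
    2 ^ (6 + k)                  ∎
    where open ≤-Reasoning

o+[5L+8]*8o≤60*L*o : ∀ {L} → 5 ≤ L → ∀ o → o + (5 * L + 8) * (8 * o) ≤ 60 * L * o
o+[5L+8]*8o≤60*L*o 5≤L o with m≤n⇒∃[o]m+o≡n 5≤L
... | m , refl = ≤-trans (m≤m+n _ ((35 + 20 * m) * o)) (≤-reflexive (identity m o))
  where
  identity : ∀ m o → (o + (5 * (5 + m) + 8) * (8 * o)) + (35 + 20 * m) * o ≡ 60 * (5 + m) * o
  identity = solve-∀

-- Thresholds

geΔ-early : ∀ {n τ i} m → i < τ → geΔ n τ i m ≡ (n ≤ᵇ m ^ (2 ^ (i ∸ 1)))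
geΔ-early {n} {τ} {i} m i<τ with i <ᵇ τ | reflects-true⁺ (<ᵇ-reflects-< i τ) i<τ
... | true | _ = refl

geΔ-last : ∀ {n τ i} m → i ≡ τ → geΔ n τ i m ≡ (n ^ 4 ≤ᵇ 2 ^ m)
geΔ-last {n} {τ} {i} m i≡τ
  with i <ᵇ τ | reflects-false⁺ (<ᵇ-reflects-< i τ) (<-irrefl i≡τ)
     | i ≡ᵇ τ | reflects-true⁺ (≡ᵇ-reflects-≡ i τ) i≡τ
... | false | _ | true | _ = refl

geΔ-late : ∀ {n τ i} m → τ < i → geΔ n τ i m ≡ (n ^ 4 ≤ᵇ 2 ^ (m * m))
geΔ-late {n} {τ} {i} m τ<i
  with i <ᵇ τ | reflects-false⁺ (<ᵇ-reflects-< i τ) (<-asym τ<i)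
     | i ≡ᵇ τ | reflects-false⁺ (≡ᵇ-reflects-≡ i τ) (λ i≡τ → <-irrefl (≡.sym i≡τ) τ<i)
... | false | _ | false | _ = refl

geΔ-mono : ∀ {n τ} i {a b} → a ≤ b → geΔ n τ i a ≡ true → geΔ n τ i b ≡ true
geΔ-mono {n} {τ} i {a} {b} a≤b high with <-cmp i τ
... | tri< i<τ _ _ rewrite geΔ-early {n} a i<τ | geΔ-early {n} b i<τ =
  ≤ᵇ-true⁺ (≤-trans (≤ᵇ-true⁻ {n} high) (^-monoˡ-≤ (2 ^ (i ∸ 1)) a≤b))
... | tri≈ _ i≡τ _ rewrite geΔ-last {n} a i≡τ | geΔ-last {n} b i≡τ =
  ≤ᵇ-true⁺ (≤-trans (≤ᵇ-true⁻ {n ^ 4} high) (^-monoʳ-≤ 2 a≤b))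
... | tri> _ _ τ<i rewrite geΔ-late {n} a τ<i | geΔ-late {n} b τ<i =
  ≤ᵇ-true⁺ (≤-trans (≤ᵇ-true⁻ {n ^ 4} high) (^-monoʳ-≤ 2 (*-mono-≤ a≤b a≤b)))

1<n^4 : ∀ {n} → 2 ≤ n → 1 < n ^ 4
1<n^4 2≤n = ≤-trans (s≤s (s≤s z≤n)) (^-monoˡ-≤ 4 2≤n)

geΔ-zero : ∀ {n} τ i → 2 ≤ n → geΔ n τ i 0 ≡ false
geΔ-zero {n} τ i 2≤n with <-cmp i τ
... | tri< i<τ _ _ rewrite geΔ-early {n} 0 i<τ =
  ≤ᵇ-false⁺ {n} (λ n≤0^K → <⇒≱ 2≤n (≤-trans n≤0^K (≤-trans (^-monoˡ-≤ (2 ^ (i ∸ 1)) z≤n) (≤-reflexive (^-zeroˡ (2 ^ (i ∸ 1)))))))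
... | tri≈ _ i≡τ _ rewrite geΔ-last {n} 0 i≡τ = ≤ᵇ-false⁺ {n ^ 4} (<⇒≱ (1<n^4 2≤n))
... | tri> _ _ τ<i rewrite geΔ-late {n} 0 τ<i = ≤ᵇ-false⁺ {n ^ 4} (<⇒≱ (1<n^4 2≤n))

geΔ-mono-false : ∀ {n τ} i {a b} → a ≤ b → geΔ n τ i b ≡ false → geΔ n τ i a ≡ false
geΔ-mono-false {n} {τ} i a≤b b-low = ≢true⇒≡false (λ a-high → true≢false (trans (≡.sym (geΔ-mono {n} {τ} i a≤b a-high)) b-low))

-- Δ_{j+1} ≤ Δ_{j+2}²; for j + 2 = τ this is where RawLe n τ, i.e. n^(1/2^(τ-1)) ≤ 4 log₂ n, is used.
geΔ-from-next : ∀ {n τ j d e} → 1 ≤ n → suc (suc j) ≤ τ → RawLe n τ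
  → geΔ n τ (suc (suc j)) d ≡ true → geΔ n τ (suc (suc j)) e ≡ true → geΔ n τ (suc j) (d * e) ≡ true
geΔ-from-next {n} {τ} {j} {d} {e} 1≤n 2+j≤τ below d-high e-high
  rewrite geΔ-early {n} {τ} {suc j} (d * e) 2+j≤τ = ≤ᵇ-true⁺ {n} n≤x
  where
  open ≤-Reasoning
  x = (d * e) ^ (2 ^ j)
  n≤x : n ≤ x
  n≤x with m≤n⇒m<n∨m≡n 2+j≤τ
  ... | inj₁ 2+j<τ = ≮⇒≥ (λ x<n → <⇒≱ (*-mono-< x<n x<n) n*n≤x*x)
    where
    early : ∀ {m} → geΔ n τ (suc (suc j)) m ≡ true → n ≤ m ^ (2 ^ suc j)
    early {m} high = ≤ᵇ-true⁻ {n} (trans (≡.sym (geΔ-early {n} m 2+j<τ)) high)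
    n*n≤x*x : n * n ≤ x * x
    n*n≤x*x = begin
      n * n                             ≤⟨ *-mono-≤ (early d-high) (early e-high) ⟩
      d ^ (2 ^ suc j) * e ^ (2 ^ suc j) ≡⟨ ≡.sym (^-distribʳ-* d e (2 ^ suc j)) ⟩
      (d * e) ^ (2 ^ suc j)             ≡⟨ ^-2^suc (d * e) j ⟩
      x * x                             ∎
  ... | inj₂ 2+j≡τ = [ (λ d≤e → via d (*-monoʳ-≤ d d≤e) (last d-high))
                     , (λ e≤d → via e (*-monoˡ-≤ e e≤d) (last e-high)) ]′ (≤-total d e)
    where
    last : ∀ {m} → geΔ n τ (suc (suc j)) m ≡ true → n ^ 4 ≤ 2 ^ m
    last {m} high = ≤ᵇ-true⁻ {n ^ 4} (trans (≡.sym (geΔ-last {n} m 2+j≡τ)) high)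
    below′ : RootBelowLog n (2 ^ suc j)
    below′ = subst (λ t → RootBelowLog n (2 ^ (t ∸ 1))) (≡.sym 2+j≡τ) below
    via : ∀ m → m * m ≤ d * e → n ^ 4 ≤ 2 ^ m → n ≤ x
    via m mm≤de n⁴≤2^m = begin
      n                         ≤⟨ RootBelowLog⇒n≤m^K 1≤n (m^n>0 2 (suc j)) below′ n⁴≤2^m ⟩
      m ^ (2 ^ suc j)           ≡⟨ ^-2^suc m j ⟩
      m ^ (2 ^ j) * m ^ (2 ^ j) ≡⟨ ≡.sym (^-distribʳ-* m m (2 ^ j)) ⟩
      (m * m) ^ (2 ^ j)         ≤⟨ ^-monoˡ-≤ (2 ^ j) mm≤de ⟩
      x                         ∎

module LargeN (n : ℕ) (32≤n : 32 ≤ n) where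

  L : ℕ
  L = ⌊log₂ n ⌋

  1≤n : 1 ≤ n
  1≤n = ≤-trans (s≤s z≤n) 32≤n

  2≤n : 2 ≤ n
  2≤n = ≤-trans (s≤s (s≤s z≤n)) 32≤n

  2^L≤n : 2 ^ L ≤ n
  2^L≤n = proj₁ (⌊log₂⌋-bounds L n refl 1≤n)

  n<2^[1+L] : n < 2 ^ suc L
  n<2^[1+L] = proj₂ (⌊log₂⌋-bounds L n refl 1≤n)

  5≤L : 5 ≤ L
  5≤L = subst (_≤ L) (⌊log₂[2^n]⌋≡n 5) (⌊log₂⌋-mono-≤ 32≤n)

  L<n : L < n
  L<n = <-≤-trans (n<2^n L) 2^L≤n

  n⁴<2^[2^L] : n ^ 4 < 2 ^ (2 ^ L)
  n⁴<2^[2^L] = begin-strict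
    n ^ 4             <⟨ ^-monoˡ-< 4 n<2^[1+L] ⟩
    (2 ^ suc L) ^ 4   ≡⟨ ^-*-assoc 2 (suc L) 4 ⟩
    2 ^ (suc L * 4)   ≤⟨ ^-monoʳ-≤ 2 ([1+m]*4≤2^m 5≤L) ⟩
    2 ^ (2 ^ L)       ∎
    where open ≤-Reasoning

  2≤τ : ∀ {τ} → IsTau n τ → 2 ≤ τ
  2≤τ {zero}          (() , _)
  2≤τ {suc zero}      (_ , below , _) = ⊥-elim (<⇒≱ (<-≤-trans n⁴<2^[2^L] (^-monoʳ-≤ 2 2^L≤n)) (below n 1 ≤-refl ≤-refl))
  2≤τ {suc (suc τ)}   _               = s≤s (s≤s z≤n)

  -- n^(1/2^(L+1)) ≤ 2 ≤ log₂ (n^4)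
  RawLe-top : RawLe n (suc (suc L))
  RawLe-top p q 1≤q p^K≤nq^K = begin
    2 ^ p          ≤⟨ ^-monoʳ-≤ 2 p≤2q ⟩
    2 ^ (2 * q)    ≡⟨ ≡.sym (^-*-assoc 2 2 q) ⟩
    4 ^ q          ≤⟨ ^-monoˡ-≤ q (≤-trans (≤ᵇ-true⁻ {4} {16} refl) (^-monoˡ-≤ 4 2≤n)) ⟩
    (n ^ 4) ^ q    ≡⟨ ^-*-assoc n 4 q ⟩
    n ^ (4 * q)    ∎
    where
    open ≤-Reasoning
    K = 2 ^ suc L
    n≤2^K : n ≤ 2 ^ K
    n≤2^K = ≤-trans (<⇒≤ n<2^[1+L]) (^-monoʳ-≤ 2 (<⇒≤ (n<2^n (suc L))))
    p^K≤[2q]^K : p ^ K ≤ (2 * q) ^ K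
    p^K≤[2q]^K = ≤-trans p^K≤nq^K (≤-trans (*-monoˡ-≤ (q ^ K) n≤2^K) (≤-reflexive (≡.sym (^-distribʳ-* 2 q K))))
    p≤2q : p ≤ 2 * q
    p≤2q = ≮⇒≥ (λ 2q<p → <⇒≱ (^-monoˡ-< K {{m^n≢0 2 (suc L)}} 2q<p) p^K≤[2q]^K)

  τ≤2+L : ∀ {τ} → IsTau n τ → τ ≤ suc (suc L)
  τ≤2+L (_ , _ , not-below) = ≮⇒≥ (λ 2+L<τ → not-below (suc (suc L)) (s≤s z≤n) 2+L<τ RawLe-top)

  t≤n+3⇒t<4n+4 : ∀ {t} → t ≤ n + 3 → t < 4 * n + 4
  t≤n+3⇒t<4n+4 t≤n+3 = ≤-trans (s≤s t≤n+3) (≤-trans (≤-reflexive (≡.sym (+-suc n 3))) (+-monoˡ-≤ 4 (m≤n*m n 4)))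

  steps-early : ∀ {τ i} → suc i < τ → steps n τ i ≤ suc (halve i (suc L)) × geΔ n τ (suc i) (2 ^ steps n τ i) ≡ true
  steps-early {τ} {i} 1+i<τ = search-spec (λ t → geΔ n τ (suc i) (2 ^ t)) (4 * n + 4) t (t≤n+3⇒t<4n+4 t≤n+3) t-high
    where
    open ≤-Reasoning
    t = suc (halve i (suc L))
    t≤n+3 : t ≤ n + 3
    t≤n+3 = ≤-trans (s≤s (≤-trans (halve-≤ i (suc L)) L<n)) (≤-trans (+-monoˡ-≤ n (s≤s z≤n)) (≤-reflexive (+-comm 3 n)))
    t-high : geΔ n τ (suc i) (2 ^ t) ≡ true
    t-high rewrite geΔ-early {n} (2 ^ t) 1+i<τ = ≤ᵇ-true⁺ {n} (begin
      n                 ≤⟨ <⇒≤ n<2^[1+L] ⟩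
      2 ^ suc L         ≤⟨ ^-monoʳ-≤ 2 (<⇒≤ (<[1+halve]*2^ i (suc L))) ⟩
      2 ^ (t * 2 ^ i)   ≡⟨ ≡.sym (^-*-assoc 2 t (2 ^ i)) ⟩
      (2 ^ t) ^ (2 ^ i) ∎)

  steps-late : ∀ {τ i} → τ ≤ suc i → steps n τ i ≤ 3 + L × geΔ n τ (suc i) (2 ^ steps n τ i) ≡ true
  steps-late {τ} {i} τ≤1+i = search-spec (λ t → geΔ n τ (suc i) (2 ^ t)) (4 * n + 4) (3 + L) (t≤n+3⇒t<4n+4 3+L≤n+3) high
    where
    3+L≤n+3 : 3 + L ≤ n + 3
    3+L≤n+3 = ≤-trans (+-monoʳ-≤ 3 (<⇒≤ L<n)) (≤-reflexive (+-comm 3 n))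
    n⁴≤2^[2^[3+L]] : n ^ 4 ≤ 2 ^ (2 ^ (3 + L))
    n⁴≤2^[2^[3+L]] = ≤-trans (<⇒≤ n⁴<2^[2^L]) (^-monoʳ-≤ 2 (^-monoʳ-≤ 2 (m≤n+m L 3)))
    high : geΔ n τ (suc i) (2 ^ (3 + L)) ≡ true
    high with m≤n⇒m<n∨m≡n τ≤1+i
    ... | inj₂ τ≡1+i rewrite geΔ-last {n} (2 ^ (3 + L)) (≡.sym τ≡1+i) = ≤ᵇ-true⁺ {n ^ 4} n⁴≤2^[2^[3+L]]
    ... | inj₁ τ<1+i rewrite geΔ-late {n} (2 ^ (3 + L)) τ<1+i =
      ≤ᵇ-true⁺ {n ^ 4} (≤-trans n⁴≤2^[2^[3+L]] (^-monoʳ-≤ 2 (m≤m*n (2 ^ (3 + L)) (2 ^ (3 + L)) {{m^n≢0 2 (3 + L)}})))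

  -- ⌈log₂ Δ_{i+1}⌉ ≈ (L+1)/2^i for the early phases, so the step counts form a geometric series.
  sumTo-steps≤5L+8 : ∀ {τ} → IsTau n τ → sumTo (steps n τ) τ ≤ 5 * L + 8
  sumTo-steps≤5L+8 {τ} isTau = bound τ (2≤τ isTau) (τ≤2+L isTau)
    where
    open ≤-Reasoning
    total : ∀ L → ((L + 2 * suc L) + (3 + L)) + (3 + L) ≡ 5 * L + 8
    total = solve-∀
    bound : ∀ τ → 2 ≤ τ → τ ≤ suc (suc L) → sumTo (steps n τ) τ ≤ 5 * L + 8
    bound (suc zero)    (s≤s ()) _
    bound (suc (suc k)) _ (s≤s (s≤s k≤L)) = begin
      (sumTo (steps n τ′) k + steps n τ′ (suc k)) + steps n τ′ (suc (suc k))
        ≤⟨ +-mono-≤ (+-mono-≤ early (proj₁ (steps-late {τ′} {suc k} ≤-refl))) (proj₁ (steps-late {τ′} {τ′} (n≤1+n τ′))) ⟩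
      ((L + 2 * suc L) + (3 + L)) + (3 + L)
        ≡⟨ total L ⟩
      5 * L + 8 ∎
      where
      τ′ = suc (suc k)
      early : sumTo (steps n τ′) k ≤ L + 2 * suc L
      early = begin
        sumTo (steps n τ′) k                      ≤⟨ sumTo-mono-≤ k (λ i _ i≤k → proj₁ (steps-early (s≤s (s≤s i≤k)))) ⟩
        sumTo (λ i → suc (halve i (suc L))) k     ≡⟨ sumTo-suc (λ i → halve i (suc L)) k ⟩
        k + sumTo (λ i → halve i (suc L)) k       ≤⟨ +-mono-≤ k≤L (sumTo-halve (suc L) k) ⟩
        L + 2 * suc L                             ∎

-- The peeling process

alive-removeV⁻ : ∀ {n} (H : SubG n) S {v} → lookup (A (removeV H S)) v ≡ true → lookup (A H) v ≡ true × lookup S v ≡ false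
alive-removeV⁻ H S {v} alive
  with ∧-true⁻ {lookup (A H) v} (trans (≡.sym (lookup∘tabulate (λ w → lookup (A H) w ∧ not (lookup S w)) v)) alive)
... | v-alive , v-kept = v-alive , not-true⁻ v-kept

deg-removeV-≤ : ∀ {n} (H : SubG n) S v → deg (removeV H S) v ≤ deg H v
deg-removeV-≤ H S v = ∣tabulate∣-mono edge
  where
  A′ = lookup (A (removeV H S))
  edge : ∀ u → A′ v ∧ (A′ u ∧ E H v u) ≡ true → lookup (A H) v ∧ (lookup (A H) u ∧ E H v u) ≡ true
  edge u e with ∧-true⁻ {A′ v} e
  ... | v-alive , e′ with ∧-true⁻ {A′ u} e′
  ... | u-alive , vu = ∧-true⁺ (proj₁ (alive-removeV⁻ H S v-alive)) (∧-true⁺ (proj₁ (alive-removeV⁻ H S u-alive)) vu)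

removeV-∪ : ∀ {n} (H : SubG n) p q → removeV H (p ∪ q) ≡ removeV (removeV H p) q
removeV-∪ H p q = cong (λ A′ → record { E = E H ; A = A′ }) (tabulate-cong pointwise)
  where
  open ≡-Reasoning
  pointwise : ∀ v → lookup (A H) v ∧ not (lookup (p ∪ q) v) ≡ lookup (A (removeV H p)) v ∧ not (lookup q v)
  pointwise v = begin
    lookup (A H) v ∧ not (lookup (p ∪ q) v)
      ≡⟨ cong (λ b → lookup (A H) v ∧ not b) (lookup-zipWith _∨_ v p q) ⟩
    lookup (A H) v ∧ not (lookup p v ∨ lookup q v)
      ≡⟨ ∧-not-∨ (lookup (A H) v) (lookup p v) (lookup q v) ⟩
    (lookup (A H) v ∧ not (lookup p v)) ∧ not (lookup q v)
      ≡⟨ cong (_∧ not (lookup q v)) (≡.sym (lookup∘tabulate (λ w → lookup (A H) w ∧ not (lookup p w)) v)) ⟩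
    lookup (A (removeV H p)) v ∧ not (lookup q v) ∎

module Peeling {n : ℕ} (G : Graph n) (O⋆ : Subset n) (τ : ℕ) where

  open Process G O⋆ τ
  open CommutativeSemigroupProperties (CommutativeMonoid.commutativeSemigroup (∪-commutativeMonoid n))
    using () renaming (interchange to ∪-interchange)

  EdgesCrossO⋆ : SubG n → Set
  EdgesCrossO⋆ H = ∀ {v u} → E H v u ≡ true → inO v ≡ false → inO u ≡ true × E H u v ≡ true

  H₁-edgesCross : IsVertexCover G O⋆ → EdgesCrossO⋆ H₁
  H₁-edgesCross cover {v} {u} e v∉ with ∧-true⁻ {adj G v u} e
  ... | vu , _ with cover v u vu
  ... | inj₁ v∈ with () ← trans (≡.sym v∈) v∉
  ... | inj₂ u∈ = u∈ , uv
    where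
    uv : adj G u v ∧ not (inO u ∧ inO v) ≡ true
    uv rewrite Graph.sym G u v | vu | u∈ | v∉ = refl

  Hph-edgesCross : IsVertexCover G O⋆ → ∀ i → EdgesCrossO⋆ (Hph i)
  Hph-edgesCross cover zero          = H₁-edgesCross cover
  Hph-edgesCross cover (suc zero)    = H₁-edgesCross cover
  Hph-edgesCross cover (suc (suc i)) = Hph-edgesCross cover (suc i)

  LowO⋆Degrees : ℕ → ℕ → SubG n → Set
  LowO⋆Degrees i k H = ∀ {u} → inO u ≡ true → lookup (A H) u ≡ true → geΔ n τ i (deg H u * 2 ^ k) ≡ false

  low-removeV : ∀ {i k H} S → LowO⋆Degrees i k H → LowO⋆Degrees i k (removeV H S)
  low-removeV {i} {k} {H} S low {u} u∈ alive =
    geΔ-mono-false {n} {τ} i (*-monoˡ-≤ (2 ^ k) (deg-removeV-≤ H S u)) (low u∈ (proj₁ (alive-removeV⁻ H S alive)))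

  low-after-step : ∀ i k H S → LowO⋆Degrees i (suc k) (removeV H (Oit i (suc k) H ∪ S))
  low-after-step i k H S {u} u∈ alive =
    geΔ-mono-false {n} {τ} i (*-monoˡ-≤ (2 ^ suc k) (deg-removeV-≤ H (O ∪ S) u)) not-high
    where
    O = Oit i (suc k) H
    kept = alive-removeV⁻ H (O ∪ S) alive
    u∉O : lookup O u ≡ false
    u∉O = ∨-conicalˡ (lookup O u) (lookup S u) (trans (≡.sym (lookup-zipWith _∨_ u O S)) (proj₂ kept))
    not-high : geΔ n τ i (deg H u * 2 ^ suc k) ≡ false
    not-high = trans (≡.sym (trans (lookup∘tabulate _ u) (cong₂ (λ a b → a ∧ (b ∧ geΔ n τ i (deg H u * 2 ^ suc k))) (proj₁ kept) u∈))) u∉O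

  Ō-step-bound : 2 ≤ n → ∀ {i k H} → EdgesCrossO⋆ H → LowO⋆Degrees i k H → ∣ Obit i (suc k) H ∣ ≤ 8 * ∣ O⋆ ∣
  Ō-step-bound 2≤n {i} {k} {H} cross low = ≤-trans (double-counting 8 edge positive ratio) (*-monoʳ-≤ 8 (p⊆q⇒∣p∣≤∣q∣ Y⊆O⋆))
    where
    alive = lookup (A H)
    R : Fin n → Fin n → Bool
    R v u = alive v ∧ (alive u ∧ E H v u)
    open DoubleCounting R
    X Y : Fin n → Bool
    X v = alive v ∧ (not (inO v) ∧ geΔ n τ i (deg H v * 2 ^ (suc k + 2)))
    Y u = alive u ∧ inO u
    high : ∀ {v} → X v ≡ true → geΔ n τ i (degree v * 2 ^ (suc k + 2)) ≡ true
    high {v} Xv = proj₂ (∧-true⁻ (proj₂ (∧-true⁻ {alive v} Xv)))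
    edge : ∀ {v u} → X v ≡ true → R v u ≡ true → Y u ≡ true × R u v ≡ true
    edge {v} {u} Xv Rvu with ∧-true⁻ {alive v} Xv | ∧-true⁻ {alive v} Rvu
    ... | v-alive , v-outside | _ , u-edge with ∧-true⁻ {alive u} u-edge
    ... | u-alive , vu with cross vu (not-true⁻ (proj₁ (∧-true⁻ v-outside)))
    ... | u∈ , uv = ∧-true⁺ u-alive u∈ , ∧-true⁺ u-alive (∧-true⁺ v-alive uv)
    positive : ∀ {v} → X v ≡ true → 1 ≤ degree v
    positive {v} Xv = n≢0⇒n>0 (λ deg≡0 → true≢false (trans (≡.sym (high Xv))
      (subst (λ d → geΔ n τ i (d * 2 ^ (suc k + 2)) ≡ false) (≡.sym deg≡0) (geΔ-zero τ i 2≤n))))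
    shift : ∀ d → d * 2 ^ (suc k + 2) ≡ 8 * d * 2 ^ k
    shift d = trans (cong (d *_) (^-distribˡ-+-* 2 (suc k) 2)) (rearrange d (2 ^ k))
      where
      rearrange : ∀ d x → d * ((2 * x) * 4) ≡ 8 * d * x
      rearrange = solve-∀
    ratio : ∀ {v u} → X v ≡ true → Y u ≡ true → degree u ≤ 8 * degree v
    ratio {v} {u} Xv Yu = ≮⇒≥ (λ 8dv<du → true≢false (trans (≡.sym (u-high 8dv<du)) (low u∈ u-alive)))
      where
      u-alive = proj₁ (∧-true⁻ {alive u} Yu)
      u∈ = proj₂ (∧-true⁻ {alive u} Yu)
      u-high : 8 * degree v < degree u → geΔ n τ i (degree u * 2 ^ k) ≡ true
      u-high 8dv<du = geΔ-mono {n} {τ} i (≤-trans (≤-reflexive (shift (degree v))) (*-monoˡ-≤ (2 ^ k) (<⇒≤ 8dv<du))) (high Xv)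
    Y⊆O⋆ : tabulate Y ⊆ O⋆
    Y⊆O⋆ {u} u∈Y = lookup⇒[]= u O⋆ (proj₂ (∧-true⁻ {alive u} (∈-tabulate⁻ u∈Y)))

  inner-O⊆O⋆ : ∀ i t r H → proj₁ (inner i t r H) ⊆ O⋆
  inner-O⊆O⋆ i t zero    H x∈ = ⊥-elim (∉⊥ x∈)
  inner-O⊆O⋆ i t (suc r) H {x} x∈ with x∈p∪q⁻ (Oit i t H) _ x∈
  ... | inj₁ x∈O  = lookup⇒[]= x O⋆ (proj₁ (∧-true⁻ (proj₂ (∧-true⁻ {lookup (A H) x} (∈-tabulate⁻ x∈O)))))
  ... | inj₂ x∈O′ = inner-O⊆O⋆ i (suc t) r _ x∈O′

  inner-Ō-bound : 2 ≤ n → ∀ i r k H → EdgesCrossO⋆ H → LowO⋆Degrees i k H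
    → ∣ proj₂ (inner i (suc k) r H) ∣ ≤ r * (8 * ∣ O⋆ ∣)
  inner-Ō-bound 2≤n i zero    k H cross low = ≤-reflexive (∣⊥∣≡0 n)
  inner-Ō-bound 2≤n i (suc r) k H cross low =
    ≤-trans (∣p∪q∣≤∣p∣+∣q∣ Ō _)
            (+-mono-≤ (Ō-step-bound 2≤n {i} {k} {H} cross low) (inner-Ō-bound 2≤n i r (suc k) _ cross (low-after-step i k H Ō)))
    where
    Ō = Obit i (suc k) H

  inner-low : ∀ i r k H → LowO⋆Degrees i k H
    → LowO⋆Degrees i (r + k) (removeV H (proj₁ (inner i (suc k) r H) ∪ proj₂ (inner i (suc k) r H)))
  inner-low i zero    k H low = low-removeV {i} {k} {H} (∅ ∪ ∅) low
  inner-low i (suc r) k H low =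
    subst₂ (LowO⋆Degrees i) (+-suc r k) removed-at-once (inner-low i r (suc k) H′ (low-after-step i k H Ō))
    where
    O  = Oit i (suc k) H
    Ō  = Obit i (suc k) H
    H′ = removeV H (O ∪ Ō)
    O′ = proj₁ (inner i (suc (suc k)) r H′)
    Ō′ = proj₂ (inner i (suc (suc k)) r H′)
    removed-at-once : removeV H′ (O′ ∪ Ō′) ≡ removeV H ((O ∪ O′) ∪ (Ō ∪ Ō′))
    removed-at-once = trans (≡.sym (removeV-∪ H (O ∪ Ō) (O′ ∪ Ō′))) (cong (removeV H) (∪-interchange O Ō O′ Ō′))

  ŌUpTo : ℕ → Subset n
  ŌUpTo zero    = ∅
  ŌUpTo (suc k) = ŌUpTo k ∪ Obi (suc k)

  unionUpTo⊆O⋆∪ŌUpTo : ∀ k → unionUpTo k ⊆ O⋆ ∪ ŌUpTo k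
  unionUpTo⊆O⋆∪ŌUpTo zero    x∈ = ⊥-elim (∉⊥ x∈)
  unionUpTo⊆O⋆∪ŌUpTo (suc k) x∈ with x∈p∪q⁻ (unionUpTo k) _ x∈
  ... | inj₁ x∈U with x∈p∪q⁻ O⋆ (ŌUpTo k) (unionUpTo⊆O⋆∪ŌUpTo k x∈U)
  ...   | inj₁ x∈O⋆ = x∈p∪q⁺ (inj₁ x∈O⋆)
  ...   | inj₂ x∈Ō  = x∈p∪q⁺ (inj₂ (x∈p∪q⁺ (inj₁ x∈Ō)))
  unionUpTo⊆O⋆∪ŌUpTo (suc k) x∈ | inj₂ x∈Oᵢ∪Ōᵢ with x∈p∪q⁻ (Oi (suc k)) (Obi (suc k)) x∈Oᵢ∪Ōᵢ
  ... | inj₁ x∈Oᵢ = x∈p∪q⁺ (inj₁ (inner-O⊆O⋆ (suc k) 1 (steps n τ (suc k)) (Hph (suc k)) x∈Oᵢ))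
  ... | inj₂ x∈Ōᵢ = x∈p∪q⁺ (inj₂ (x∈p∪q⁺ (inj₂ x∈Ōᵢ)))

  ∣ŌUpTo∣≤ : ∀ k → ∣ ŌUpTo k ∣ ≤ sumTo (λ i → ∣ Obi i ∣) k
  ∣ŌUpTo∣≤ zero    = ≤-reflexive (∣⊥∣≡0 n)
  ∣ŌUpTo∣≤ (suc k) = ≤-trans (∣p∪q∣≤∣p∣+∣q∣ (ŌUpTo k) (Obi (suc k))) (+-monoˡ-≤ ∣ Obi (suc k) ∣ (∣ŌUpTo∣≤ k))

  module Analysis (cover : IsVertexCover G O⋆) (32≤n : 32 ≤ n) (isTau : IsTau n τ) where

    open LargeN n 32≤n

    H₁-low : LowO⋆Degrees 1 0 H₁
    H₁-low {u} _ _ rewrite geΔ-early {n} (deg H₁ u * 1) (2≤τ isTau) =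
      ≤ᵇ-false⁺ {n} (λ n≤deg → <⇒≱ deg<n (≤-trans n≤deg (≤-reflexive (trans (*-identityʳ _) (*-identityʳ _)))))
      where
      no-loop : lookup ⊤ u ∧ (lookup ⊤ u ∧ E H₁ u u) ≡ false
      no-loop rewrite irrefl G u = trans (cong (lookup ⊤ u ∧_) (∧-zeroʳ (lookup ⊤ u))) (∧-zeroʳ (lookup ⊤ u))
      deg<n : deg H₁ u < n
      deg<n = ∣tabulate∣<n _ u no-loop

    next-phase-low : ∀ {j s H} → suc (suc j) ≤ τ → geΔ n τ (suc (suc j)) (2 ^ s) ≡ true
      → LowO⋆Degrees (suc j) s H → LowO⋆Degrees (suc (suc j)) 0 H
    next-phase-low {j} {s} {H} 2+j≤τ 2^s-high low {u} u∈ alive =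
      ≢true⇒≡false (λ u-high → true≢false (trans (≡.sym (product-high u-high)) (low u∈ alive)))
      where
      product-high : geΔ n τ (suc (suc j)) (deg H u * 1) ≡ true → geΔ n τ (suc j) (deg H u * 2 ^ s) ≡ true
      product-high u-high = subst (λ d → geΔ n τ (suc j) (d * 2 ^ s) ≡ true) (*-identityʳ (deg H u))
                                  (geΔ-from-next 1≤n 2+j≤τ (proj₁ (proj₂ isTau)) u-high 2^s-high)

    phase-low : ∀ j → suc j ≤ τ → LowO⋆Degrees (suc j) 0 (Hph (suc j))
    phase-low zero    _     = H₁-low
    phase-low (suc j) 2+j≤τ = next-phase-low {j} {s} {Hph (suc (suc j))} 2+j≤τ last-step-high
      (subst (λ k → LowO⋆Degrees (suc j) k (Hph (suc (suc j)))) (+-identityʳ s)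
             (inner-low (suc j) s 0 (Hph (suc j)) (phase-low j (≤-trans (n≤1+n (suc j)) 2+j≤τ))))
      where
      s = steps n τ (suc j)
      last-step-high : geΔ n τ (suc (suc j)) (2 ^ s) ≡ true
      last-step-high with m≤n⇒m<n∨m≡n 2+j≤τ
      ... | inj₁ 2+j<τ = proj₂ (steps-early 2+j<τ)
      ... | inj₂ 2+j≡τ = proj₂ (steps-late (≤-reflexive (≡.sym 2+j≡τ)))

    ∣Obi∣≤ : ∀ i → 1 ≤ i → i ≤ τ → ∣ Obi i ∣ ≤ steps n τ i * (8 * ∣ O⋆ ∣)
    ∣Obi∣≤ (suc j) _ 1+j≤τ =
      inner-Ō-bound 2≤n (suc j) (steps n τ (suc j)) 0 (Hph (suc j)) (Hph-edgesCross cover (suc j)) (phase-low j 1+j≤τ)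

    allRemoved-bound : ∣ allRemoved ∣ ≤ 60 * L * ∣ O⋆ ∣
    allRemoved-bound = begin
      ∣ allRemoved ∣                                        ≤⟨ p⊆q⇒∣p∣≤∣q∣ (unionUpTo⊆O⋆∪ŌUpTo τ) ⟩
      ∣ O⋆ ∪ ŌUpTo τ ∣                                      ≤⟨ ∣p∪q∣≤∣p∣+∣q∣ O⋆ (ŌUpTo τ) ⟩
      ∣ O⋆ ∣ + ∣ ŌUpTo τ ∣                                   ≤⟨ +-monoʳ-≤ ∣ O⋆ ∣ (≤-trans (∣ŌUpTo∣≤ τ) (sumTo-mono-≤ τ ∣Obi∣≤)) ⟩
      ∣ O⋆ ∣ + sumTo (λ i → steps n τ i * (8 * ∣ O⋆ ∣)) τ   ≡⟨ cong (∣ O⋆ ∣ +_) (sumTo-*ʳ (steps n τ) (8 * ∣ O⋆ ∣) τ) ⟩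
      ∣ O⋆ ∣ + sumTo (steps n τ) τ * (8 * ∣ O⋆ ∣)           ≤⟨ +-monoʳ-≤ ∣ O⋆ ∣ (*-monoˡ-≤ (8 * ∣ O⋆ ∣) (sumTo-steps≤5L+8 isTau)) ⟩
      ∣ O⋆ ∣ + (5 * L + 8) * (8 * ∣ O⋆ ∣)                   ≤⟨ o+[5L+8]*8o≤60*L*o 5≤L ∣ O⋆ ∣ ⟩
      60 * L * ∣ O⋆ ∣                                       ∎
      where open ≤-Reasoning

lemma1 : ∃[ C ] ∃[ n₀ ] (∀ (n : ℕ) → n₀ ≤ n → (G : Graph n) (O⋆ : Subset n) → IsMinVertexCover G O⋆
           → (τ : ℕ) → IsTau n τ
           → ∣ Process.allRemoved G O⋆ τ ∣ ≤ C * ⌊log₂ n ⌋ * ∣ O⋆ ∣)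
lemma1 = 60 , 32 , λ n 32≤n G O⋆ (cover , _) τ isTau → Peeling.Analysis.allRemoved-bound G O⋆ τ cover 32≤n isTau
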